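{- If $P$ and $Q$ are nonempty finite sets of partitions, then the following are equivalent: (i) $\mathrm{cl}(P)=\mathrm{cl}(Q)$; (ii) $\mathrm{pr}(P)=\mathrm{pr}(Q)$; (iii) $\vee_P(\mu)=\vee_Q(\mu)$ for every partition $\mu$.
   Context: A partition is a weakly decreasing sequence $\sigma=(\sigma_1,\sigma_2,\ldots)$ of nonnegative integers with finitely many positive terms, with the convention $\sigma_\infty=0$, indices in $[1,\infty]$. Splicing: for partitions $\alpha,\beta$ and $i>0$ with $\alpha_i>\beta_{i+1}$ (strict), $\alpha\star_i\beta=(\alpha_1,\ldots,\alpha_i,\beta_{i+1},\beta_{i+2},\ldots)$; $\mathrm{cl}(P)$ is the closure of $P$ under splicing. Sum: $\mu+\alpha=(\mu_1+\alpha_1,\mu_2+\alpha_2,\ldots)$. $\alpha\vee\beta$ is the partition in which each positive integer has multiplicity equal to the maximum of its multiplicities in $\alpha$ and $\beta$; for finite nonempty $P=\{\alpha^{(1)},\ldots,\alpha^{(s)}\}$, $\vee_P(\mu)=(\mu+\alpha^{(1)})\vee\cdots\vee(\mu+\alpha^{(s)})$. The $p$-interval of $\sigma$ ($p\ge0$) is $\{i\in[1,\infty]:\sigma_i=p\}$. For finite nonempty $P$, $\mathrm{pr}_p(P)=\{(p,I):I$ is an inclusion-maximal element of the set of nonempty $p$-intervals of members of $P\}$, and the profile is $\mathrm{pr}(P)=\bigcup_{p\ge0}\mathrm{pr}_p(P)$. -}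

module Defs where

open import Level using (Level; _⊔_) renaming (suc to lsuc)
open import Data.Nat using (ℕ; zero; suc; _+_; _<_; _≥_)
open import Data.List using (List; []; _∷_; take; drop; _++_; foldr; map)
open import Data.List.Relation.Unary.All using (All)
open import Data.List.Relation.Unary.Linked using (Linked)
open import Data.List.Membership.Propositional using (_∈_)
open import Data.Product using (Σ; ∃; _×_)
open import Relation.Binary.PropositionalEquality using (_≡_)
open import Relation.Nullary using (yes; no)
open import Data.Nat using (_<?_)

-- A partition is represented canonically by the list of its positive parts
-- (σ₁ ≥ σ₂ ≥ … ≥ σ_ℓ > 0); all later terms are 0.
IsPartition : List ℕ → Set
IsPartition σ = Linked _≥_ σ × All (0 <_) σ

-- Indices in [1,∞]:  at k  denotes the index k+1, and  ∞  denotes ∞.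
data Idx : Set where
  at : ℕ → Idx
  ∞  : Idx

-- idx σ k = σ_{k+1}  (0 beyond the length)
idx : List ℕ → ℕ → ℕ
idx []       _       = 0
idx (x ∷ _)  zero    = x
idx (_ ∷ xs) (suc k) = idx xs k

val : List ℕ → Idx → ℕ
val σ (at k) = idx σ k
val σ ∞      = 0

-- Splicing:  α ⋆_i β  with i = suc k, defined when α_i > β_{i+1}.
splice : ℕ → List ℕ → List ℕ → List ℕ
splice k α β = take (suc k) α ++ drop (suc k) β

data Cl (P : List (List ℕ)) : List ℕ → Set where
  base   : ∀ {σ} → σ ∈ P → Cl P σ
  splice-step : ∀ {α β} (k : ℕ) → Cl P α → Cl P β →
                idx β (suc k) < idx α k → Cl P (splice k α β)

add : List ℕ → List ℕ → List ℕ
add []       ys       = ys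
add xs       []       = xs
add (x ∷ xs) (y ∷ ys) = x + y ∷ add xs ys

-- α ∨ β for partitions (weakly decreasing lists of positive parts):
-- the multiplicity of each positive integer is the max of its multiplicities.
join : List ℕ → List ℕ → List ℕ
join []       ys = ys
join (x ∷ xs) ys = go ys
  where
  go : List ℕ → List ℕ
  go []       = x ∷ xs
  go (y ∷ ys) with y <? x | x <? y
  ... | yes _ | _     = x ∷ join xs (y ∷ ys)
  ... | no _  | yes _ = y ∷ go ys
  ... | no _  | no _  = x ∷ join xs ys

joinAll : List (List ℕ) → List ℕ → List ℕ
joinAll P μ = foldr join [] (map (add μ) P)

pInterval : ℕ → List ℕ → Idx → Set
pInterval p σ i = val σ i ≡ p

_⊆_ : (Idx → Set) → (Idx → Set) → Set
I ⊆ J = ∀ i → I i → J i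

_≐_ : (Idx → Set) → (Idx → Set) → Set
I ≐ J = I ⊆ J × J ⊆ I

InPr : List (List ℕ) → ℕ → (Idx → Set) → Set
InPr P p I =
  (Σ (List ℕ) λ σ → σ ∈ P × I ≐ pInterval p σ)
  × (∃ λ i → I i)
  × (∀ τ → τ ∈ P → I ⊆ pInterval p τ → pInterval p τ ⊆ I)

_⟺_ : ∀ {a b : Level} → Set a → Set b → Set (a ⊔ b)
A ⟺ B = (A → B) × (B → A)

module Submission where

-- All three are shown equivalent to mutual *domination*, where
-- P ≼ Q means that every nonempty p-interval of a member of P lies inside the
-- p-interval of some member of Q.
--  * Closure.  A splice α ⋆ₖ β copies α before and β after a strict descent, so
--    each of its intervals lies inside an interval of α or of β; hence members of
--    cl(P) are dominated by P.  Conversely a partition dominated by P is rebuilt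
--    from the right by splicing members of P along its descents.  So
--    cl(P) ⊆ cl(Q) iff P ≼ Q.
--  * Profile.  Under mutual domination the maximal intervals of P and Q agree;
--    conversely every interval lies below a maximal one, which is in pr(Q).
--  * Joins.  The multiplicity of v in ∨_P(μ) is the maximum over α ∈ P of its
--    multiplicity in μ + α, and splicing never raises these multiplicities, so
--    (i) gives (iii).  Conversely, for an interval of α ∈ P a test partition μ
--    and value v make the v-positions of μ + β exactly the points of the interval
--    where β takes the value p; equal maximal multiplicities then force some
--    β ∈ Q to contain the interval, so (iii) gives domination.

open import Defs
open import Data.Nat
open import Data.Nat.Properties
open import Data.Nat.ListAction using (sum)
open import Data.Fin using (Fin; toℕ; fromℕ<)
open import Data.Fin.Properties using (all?; toℕ-fromℕ<)
open import Data.List using (List; []; _∷_; take; drop; _++_; foldr; map; length; replicate)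
open import Data.List.Properties using (take++drop≡id)
open import Data.List.Relation.Unary.All using (All; []; _∷_; lookup; universal) renaming (map to all-map)
import Data.List.Relation.Unary.All.Properties as All
open import Data.List.Relation.Unary.AllPairs using (AllPairs; []; _∷_)
import Data.List.Relation.Unary.AllPairs.Properties as AllPairs
open import Data.List.Relation.Unary.Any using (here; there)
open import Data.List.Relation.Unary.Linked.Properties using (Linked⇒AllPairs; AllPairs⇒Linked)
open import Data.List.Membership.Propositional using (_∈_)
open import Data.Product using (Σ; _×_; _,_; proj₁; proj₂)
open import Data.Sum using (_⊎_; inj₁; inj₂; [_,_]′)
open import Data.Empty using (⊥-elim)
open import Relation.Nullary using (yes; no; Dec)
open import Relation.Nullary.Decidable using (map′; _→-dec_)
open import Relation.Binary using (tri<; tri≈; tri>)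
open import Relation.Binary.PropositionalEquality
open import Function using (_∘_)

-- Weakly decreasing lists, in the AllPairs form (more convenient than Linked).
Sorted : List ℕ → Set
Sorted = AllPairs _≥_

Positive : List ℕ → Set
Positive = All (0 <_)

Partition : List ℕ → Set
Partition σ = Sorted σ × Positive σ

fromIsPartition : ∀ {σ} → IsPartition σ → Partition σ
fromIsPartition (linked , pos) = Linked⇒AllPairs (λ x≥y y≥z → ≤-trans y≥z x≥y) linked , pos

toIsPartition : ∀ {σ} → Partition σ → IsPartition σ
toIsPartition (sorted , pos) = AllPairs⇒Linked sorted , pos

idx-≤ : ∀ {b} xs j → All (_≤ b) xs → idx xs j ≤ b
idx-≤ []       j       _        = z≤n
idx-≤ (x ∷ xs) zero    (x≤b ∷ _) = x≤b
idx-≤ (x ∷ xs) (suc j) (_ ∷ xs≤b) = idx-≤ xs j xs≤b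

idx-antitone : ∀ xs {j j'} → Sorted xs → j ≤ j' → idx xs j' ≤ idx xs j
idx-antitone []       _                 _ = z≤n
idx-antitone (x ∷ xs) {zero}  {zero}    _ _ = ≤-refl
idx-antitone (x ∷ xs) {zero}  {suc j'}  (x≥xs ∷ _) _ = idx-≤ xs j' x≥xs
idx-antitone (x ∷ xs) {suc j} {suc j'}  (_ ∷ s) (s≤s j≤j') = idx-antitone xs s j≤j'

idx-beyond : ∀ xs j → length xs ≤ j → idx xs j ≡ 0
idx-beyond []       j       _ = refl
idx-beyond (x ∷ xs) (suc j) (s≤s len≤j) = idx-beyond xs j len≤j

idx-positive : ∀ xs j → Positive xs → j < length xs → 0 < idx xs j
idx-positive (x ∷ xs) zero    (x>0 ∷ _) _ = x>0
idx-positive (x ∷ xs) (suc j) (_ ∷ pos) (s≤s j<len) = idx-positive xs j pos j<len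

positive-ext : ∀ xs ys → Positive xs → Positive ys → (∀ j → idx xs j ≡ idx ys j) → xs ≡ ys
positive-ext []       []       _ _ _ = refl
positive-ext []       (y ∷ ys) _ (y>0 ∷ _) same = ⊥-elim (<-irrefl (same 0) y>0)
positive-ext (x ∷ xs) []       (x>0 ∷ _) _ same = ⊥-elim (<-irrefl (sym (same 0)) x>0)
positive-ext (x ∷ xs) (y ∷ ys) (_ ∷ pxs) (_ ∷ pys) same =
  cong₂ _∷_ (same 0) (positive-ext xs ys pxs pys (λ j → same (suc j)))

idx-take : ∀ n xs j → j < n → idx (take n xs) j ≡ idx xs j
idx-take (suc n) []       j       _ = refl
idx-take (suc n) (x ∷ xs) zero    _ = refl
idx-take (suc n) (x ∷ xs) (suc j) (s≤s j<n) = idx-take n xs j j<n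

idx-drop : ∀ n xs j → idx (drop n xs) j ≡ idx xs (n + j)
idx-drop zero    xs       j = refl
idx-drop (suc n) []       j = refl
idx-drop (suc n) (x ∷ xs) j = idx-drop n xs j

take-≥ : ∀ k xs → Sorted xs → All (idx xs k ≤_) (take (suc k) xs)
take-≥ k       []       _ = []
take-≥ zero    (x ∷ xs) _ = ≤-refl ∷ []
take-≥ (suc k) (x ∷ xs) (x≥xs ∷ s) = idx-≤ xs k x≥xs ∷ take-≥ k xs s

drop-≤ : ∀ n xs → Sorted xs → All (_≤ idx xs n) (drop n xs)
drop-≤ zero    []       _ = []
drop-≤ zero    (x ∷ xs) (x≥xs ∷ _) = ≤-refl ∷ x≥xs
drop-≤ (suc n) []       _ = []
drop-≤ (suc n) (x ∷ xs) (_ ∷ s) = drop-≤ n xs s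

-- Splicing

-- When α_k > 0 the list α has more than k entries, so  take (k+1) α ++ ys
-- splits back into  take (k+1) α  and  ys.
take-prefix : ∀ k α ys → 0 < idx α k → take (suc k) (take (suc k) α ++ ys) ≡ take (suc k) α
take-prefix zero    (a ∷ α) ys _ = refl
take-prefix (suc k) (a ∷ α) ys αk>0 = cong (a ∷_) (take-prefix k α ys αk>0)

drop-prefix : ∀ k α ys → 0 < idx α k → drop (suc k) (take (suc k) α ++ ys) ≡ ys
drop-prefix zero    (a ∷ α) ys _ = refl
drop-prefix (suc k) (a ∷ α) ys αk>0 = drop-prefix k α ys αk>0

module _ (k : ℕ) (α β : List ℕ) (αk>0 : 0 < idx α k) where
  splice-low : ∀ j → j ≤ k → idx (splice k α β) j ≡ idx α j
  splice-low j j≤k = begin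
    idx (splice k α β) j                ≡⟨ idx-take (suc k) (splice k α β) j (s≤s j≤k) ⟨
    idx (take (suc k) (splice k α β)) j ≡⟨ cong (λ xs → idx xs j) (take-prefix k α _ αk>0) ⟩
    idx (take (suc k) α) j              ≡⟨ idx-take (suc k) α j (s≤s j≤k) ⟩
    idx α j                             ∎
    where open ≡-Reasoning

  splice-high : ∀ j → k < j → idx (splice k α β) j ≡ idx β j
  splice-high j k<j = begin
    idx (splice k α β) j                ≡⟨ cong (idx (splice k α β)) j≡ ⟨
    idx (splice k α β) (suc k + d)      ≡⟨ idx-drop (suc k) (splice k α β) d ⟨
    idx (drop (suc k) (splice k α β)) d ≡⟨ cong (λ xs → idx xs d) (drop-prefix k α _ αk>0) ⟩
    idx (drop (suc k) β) d              ≡⟨ idx-drop (suc k) β d ⟩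
    idx β (suc k + d)                   ≡⟨ cong (idx β) j≡ ⟩
    idx β j                             ∎
    where
    open ≡-Reasoning
    d : ℕ
    d = j ∸ suc k
    j≡ : suc k + d ≡ j
    j≡ = m+[n∸m]≡n k<j

splice-partition : ∀ k α β → Partition α → Partition β → idx β (suc k) < idx α k →
                   Partition (splice k α β)
splice-partition k α β (sα , pα) (sβ , pβ) guard =
  AllPairs.++⁺ (AllPairs.take⁺ (suc k) sα) (AllPairs.drop⁺ (suc k) sβ)
    (all-map (λ αk≤x → all-map (λ y≤βk → <⇒≤ (≤-<-trans y≤βk (<-≤-trans guard αk≤x)))
                               (drop-≤ (suc k) β sβ))
             (take-≥ k α sα))
  , All.++⁺ (All.take⁺ (suc k) pα) (All.drop⁺ (suc k) pβ)

closure-partition : ∀ {P γ} → All Partition P → Cl P γ → Partition γ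
closure-partition ps (base γ∈P) = lookup ps γ∈P
closure-partition ps (splice-step k cα cβ guard) =
  splice-partition k _ _ (closure-partition ps cα) (closure-partition ps cβ) guard

⊆-refl : ∀ {I} → I ⊆ I
⊆-refl _ x = x

⊆-trans : ∀ {I J K} → I ⊆ J → J ⊆ K → I ⊆ K
⊆-trans I⊆J J⊆K i x = J⊆K i (I⊆J i x)

-- Positions ≤ k of α ⋆ₖ β carry values ≥ α_k > β_{k+1}, later ones values
-- ≤ β_{k+1}; so a p-interval of the splice lies in that of α when p > β_{k+1}
-- and in that of β when p ≤ β_{k+1}.
module SpliceIntervals {k α β} (sα : Sorted α) (sβ : Sorted β) (guard : idx β (suc k) < idx α k) where
  private
    γ : List ℕ
    γ = splice k α β
    αk>0 : 0 < idx α k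
    αk>0 = ≤-<-trans z≤n guard

  interval-left : ∀ p → idx β (suc k) < p → pInterval p γ ⊆ pInterval p α
  interval-left p βk<p (at j) γj≡p with j ≤? k
  ... | yes j≤k = trans (sym (splice-low k α β αk>0 j j≤k)) γj≡p
  ... | no  j≰k = ⊥-elim (<-irrefl γj≡p (begin-strict
        idx γ j        ≡⟨ splice-high k α β αk>0 j (≰⇒> j≰k) ⟩
        idx β j        ≤⟨ idx-antitone β sβ (≰⇒> j≰k) ⟩
        idx β (suc k)  <⟨ βk<p ⟩
        p              ∎))
    where open ≤-Reasoning
  interval-left p βk<p ∞ 0≡p = ⊥-elim (<-irrefl 0≡p (≤-<-trans z≤n βk<p))

  interval-right : ∀ p → p ≤ idx β (suc k) → pInterval p γ ⊆ pInterval p β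
  interval-right p p≤βk (at j) γj≡p with j ≤? k
  ... | no  j≰k = trans (sym (splice-high k α β αk>0 j (≰⇒> j≰k))) γj≡p
  ... | yes j≤k = ⊥-elim (<-irrefl (sym γj≡p) (begin-strict
        p              ≤⟨ p≤βk ⟩
        idx β (suc k)  <⟨ guard ⟩
        idx α k        ≤⟨ idx-antitone α sα j≤k ⟩
        idx α j        ≡⟨ splice-low k α β αk>0 j j≤k ⟨
        idx γ j        ∎))
    where open ≤-Reasoning
  interval-right p p≤βk ∞ 0≡p = 0≡p

  splice-interval : ∀ p → pInterval p γ ⊆ pInterval p α ⊎ pInterval p γ ⊆ pInterval p β
  splice-interval p with p ≤? idx β (suc k)
  ... | yes p≤βk = inj₂ (interval-right p p≤βk)
  ... | no  p≰βk = inj₁ (interval-left p (≰⇒> p≰βk))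

Covered : List (List ℕ) → List ℕ → Set
Covered P σ = ∀ p i → val σ i ≡ p → Σ (List ℕ) λ τ → τ ∈ P × pInterval p σ ⊆ pInterval p τ

covered-from-parts : ∀ {P σ α β} →
  (∀ p → pInterval p σ ⊆ pInterval p α ⊎ pInterval p σ ⊆ pInterval p β) →
  Covered P α → Covered P β → Covered P σ
covered-from-parts split cα cβ p i σi≡p with split p
... | inj₁ σ⊆α = let (τ , τ∈P , α⊆τ) = cα p i (σ⊆α i σi≡p) in τ , τ∈P , ⊆-trans σ⊆α α⊆τ
... | inj₂ σ⊆β = let (τ , τ∈P , β⊆τ) = cβ p i (σ⊆β i σi≡p) in τ , τ∈P , ⊆-trans σ⊆β β⊆τ

closure-covered : ∀ {P γ} → All Partition P → Cl P γ → Covered P γ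
closure-covered ps (base γ∈P) p i _ = _ , γ∈P , ⊆-refl
closure-covered ps (splice-step {α} {β} k cα cβ guard) =
  covered-from-parts (SpliceIntervals.splice-interval sα sβ guard)
                     (closure-covered ps cα) (closure-covered ps cβ)
  where
  sα : Sorted α
  sα = proj₁ (closure-partition ps cα)
  sβ : Sorted β
  sβ = proj₁ (closure-partition ps cβ)

AgreesFrom : List ℕ → ℕ → List ℕ → Set
AgreesFrom σ k γ = ∀ j → (idx σ j ≡ idx σ k ⊎ k ≤ j) → idx γ j ≡ idx σ j

-- A covered partition σ is rebuilt from the right: for decreasing k we find
-- γ ∈ cl(P) agreeing with σ from k on.
module Rebuild (P : List (List ℕ)) (σ : List ℕ) (sσ : Sorted σ) (cov : Covered P σ) where
  Stage : ℕ → Set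
  Stage k = Σ (List ℕ) λ γ → Cl P γ × AgreesFrom σ k γ

  -- Beyond the length of σ, a member of P covering the 0-interval works.
  stage-end : ∀ k → length σ ≤ k → Stage k
  stage-end k len≤k with cov 0 ∞ refl
  ... | β , β∈P , zeros⊆β = β , base β∈P , λ j c → trans (zeros⊆β (at j) (σj≡0 j c)) (sym (σj≡0 j c))
    where
    σj≡0 : ∀ j → (idx σ j ≡ idx σ k ⊎ k ≤ j) → idx σ j ≡ 0
    σj≡0 j (inj₁ σj≡σk) = trans σj≡σk (idx-beyond σ k len≤k)
    σj≡0 j (inj₂ k≤j)   = idx-beyond σ j (≤-trans len≤k k≤j)

  stage-plateau : ∀ k → idx σ (suc k) ≡ idx σ k → Stage (suc k) → Stage k
  stage-plateau k flat (γ , cγ , agree) = γ , cγ , λ j c → agree j (shift j c)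
    where
    shift : ∀ j → (idx σ j ≡ idx σ k ⊎ k ≤ j) → (idx σ j ≡ idx σ (suc k) ⊎ suc k ≤ j)
    shift j (inj₁ σj≡σk) = inj₁ (trans σj≡σk (sym flat))
    shift j (inj₂ k≤j) with m≤n⇒m<n∨m≡n k≤j
    ... | inj₁ k<j  = inj₂ k<j
    ... | inj₂ refl = inj₁ (sym flat)

  -- At a strict descent σ_{k+1} < σ_k, splice a member of P covering the
  -- σ_k-interval onto the stage for k+1.
  stage-descent : ∀ k → idx σ (suc k) < idx σ k → Stage (suc k) → Stage k
  stage-descent k descent (γ , cγ , agree) with cov (idx σ k) (at k) refl
  ... | β , β∈P , σk⊆β = splice k β γ , splice-step k (base β∈P) cγ guard , agreement
    where
    βk≡σk : idx β k ≡ idx σ k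
    βk≡σk = σk⊆β (at k) refl
    guard : idx γ (suc k) < idx β k
    guard = subst₂ _<_ (sym (agree (suc k) (inj₂ ≤-refl))) (sym βk≡σk) descent
    βk>0 : 0 < idx β k
    βk>0 = ≤-<-trans z≤n guard
    β-agrees : ∀ {j} → j ≤ k → (idx σ j ≡ idx σ k ⊎ k ≤ j) → idx β j ≡ idx σ j
    β-agrees j≤k (inj₁ σj≡σk) = trans (σk⊆β (at _) σj≡σk) (sym σj≡σk)
    β-agrees j≤k (inj₂ k≤j) with ≤-antisym j≤k k≤j
    ... | refl = βk≡σk
    agreement : AgreesFrom σ k (splice k β γ)
    agreement j c with j ≤? k
    ... | yes j≤k = trans (splice-low k β γ βk>0 j j≤k) (β-agrees j≤k c)
    ... | no  j≰k = trans (splice-high k β γ βk>0 j (≰⇒> j≰k)) (agree j (inj₂ (≰⇒> j≰k)))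

  stage : ∀ d k → k + d ≡ length σ → Stage k
  stage zero    k k≡len = stage-end k (≤-reflexive (trans (sym k≡len) (+-identityʳ k)))
  stage (suc d) k k+d≡len =
    [ stage-descent k , stage-plateau k ]′ (m≤n⇒m<n∨m≡n (idx-antitone σ sσ (n≤1+n k)))
      (stage d (suc k) (trans (sym (+-suc k d)) k+d≡len))

covered-closure : ∀ {P σ} → All Partition P → Partition σ → Covered P σ → Cl P σ
covered-closure {P} {σ} ps (sσ , pσ) cov with Rebuild.stage P σ sσ cov (length σ) 0 refl
... | γ , cγ , agree =
  subst (Cl P) (positive-ext γ σ (proj₂ (closure-partition ps cγ)) pσ (λ j → agree j (inj₂ z≤n))) cγ

_≼_ : List (List ℕ) → List (List ℕ) → Set
P ≼ Q = ∀ σ → σ ∈ P → Covered Q σ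

covered-trans : ∀ {P Q σ} → Covered P σ → P ≼ Q → Covered Q σ
covered-trans cov P≼Q p i σi≡p =
  let (β , β∈P , σ⊆β) = cov p i σi≡p
      (τ , τ∈Q , β⊆τ) = P≼Q β β∈P p i (σ⊆β i σi≡p)
  in τ , τ∈Q , ⊆-trans σ⊆β β⊆τ

closure⊆⇒≼ : ∀ {P Q} → All Partition Q → (∀ σ → Cl P σ → Cl Q σ) → P ≼ Q
closure⊆⇒≼ psQ cl⊆ σ σ∈P = closure-covered psQ (cl⊆ σ (base σ∈P))

≼⇒closure⊆ : ∀ {P Q} → All Partition P → All Partition Q → P ≼ Q → ∀ σ → Cl P σ → Cl Q σ
≼⇒closure⊆ psP psQ P≼Q σ cσ =
  covered-closure psQ (closure-partition psP cσ) (covered-trans (closure-covered psP cσ) P≼Q)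

-- Profiles

-- Under mutual domination, a maximal p-interval of P is one of Q: the member
-- of Q covering it is in turn covered by a member of P, which by maximality
-- gives back the interval itself.
profile⊆ : ∀ {P Q} → P ≼ Q → Q ≼ P → ∀ p I → InPr P p I → InPr Q p I
profile⊆ P≼Q Q≼P p I ((σ , σ∈P , I⊆σ , σ⊆I) , (i , Ii) , maxP) =
  let (τ , τ∈Q , σ⊆τ)   = P≼Q σ σ∈P p i (I⊆σ i Ii)
      (σ' , σ'∈P , τ⊆σ') = Q≼P τ τ∈Q p i (σ⊆τ i (I⊆σ i Ii))
      σ'⊆I              = maxP σ' σ'∈P (⊆-trans I⊆σ (⊆-trans σ⊆τ τ⊆σ'))
  in (τ , τ∈Q , ⊆-trans I⊆σ σ⊆τ , ⊆-trans τ⊆σ' σ'⊆I) , (i , Ii) , maxQ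
  where
  maxQ : ∀ τ → τ ∈ _ → I ⊆ pInterval p τ → pInterval p τ ⊆ I
  maxQ τ τ∈Q I⊆τ =
    let (σ' , σ'∈P , τ⊆σ') = Q≼P τ τ∈Q p i (I⊆τ i Ii)
    in ⊆-trans τ⊆σ' (maxP σ' σ'∈P (⊆-trans I⊆τ τ⊆σ'))

-- Inclusion of p-intervals is decidable: positions beyond both lengths carry 0
-- in both lists, so only finitely many positions need checking.
interval-⊆? : ∀ p β γ → Dec (pInterval p β ⊆ pInterval p γ)
interval-⊆? p β γ = map′ extend restrict (all? (λ j → (idx β (toℕ j) ≟ p) →-dec (idx γ (toℕ j) ≟ p)))
  where
  L : ℕ
  L = length β + length γ
  extend : (∀ (j : Fin L) → idx β (toℕ j) ≡ p → idx γ (toℕ j) ≡ p) → pInterval p β ⊆ pInterval p γ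
  extend below (at j) βj≡p with j <? L
  ... | yes j<L = subst (λ n → idx β n ≡ p → idx γ n ≡ p) (toℕ-fromℕ< j<L) (below (fromℕ< j<L)) βj≡p
  ... | no  j≮L = trans (idx-beyond γ j (≤-trans (m≤n+m _ _) L≤j))
                        (trans (sym (idx-beyond β j (≤-trans (m≤m+n _ _) L≤j))) βj≡p)
    where L≤j = ≮⇒≥ j≮L
  extend below ∞ 0≡p = 0≡p
  restrict : pInterval p β ⊆ pInterval p γ → ∀ (j : Fin L) → idx β (toℕ j) ≡ p → idx γ (toℕ j) ≡ p
  restrict β⊆γ j = β⊆γ (at (toℕ j))

module _ {A : Set} (_≲_ : A → A → Set) (_≲?_ : ∀ x y → Dec (x ≲ y))
         (≲-refl : ∀ {x} → x ≲ x) (≲-trans : ∀ {x y z} → x ≲ y → y ≲ z → x ≲ z) where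
  maximal-above : ∀ x L → Σ A λ y → y ∈ x ∷ L × x ≲ y × (∀ z → z ∈ L → y ≲ z → z ≲ y)
  maximal-above x [] = x , here refl , ≲-refl , λ _ ()
  maximal-above x (z ∷ L) with x ≲? z
  ... | yes x≲z =
    let (y , y∈ , z≲y , maxL) = maximal-above z L
    in y , there y∈ , ≲-trans x≲z z≲y ,
       λ { w (here refl) _ → z≲y ; w (there w∈L) → maxL w w∈L }
  ... | no x≴z =
    let (y , y∈ , x≲y , maxL) = maximal-above x L
    in y , skip y∈ , x≲y ,
       λ { w (here refl) y≲z → ⊥-elim (x≴z (≲-trans x≲y y≲z)) ; w (there w∈L) → maxL w w∈L }
    where
    skip : ∀ {y} → y ∈ x ∷ L → y ∈ x ∷ z ∷ L
    skip (here y≡x) = here y≡x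
    skip (there y∈L) = there (there y∈L)

  maximal-in : ∀ {x} L → x ∈ L → Σ A λ y → y ∈ L × x ≲ y × (∀ z → z ∈ L → y ≲ z → z ≲ y)
  maximal-in {x} L x∈L =
    let (y , y∈ , x≲y , maximal) = maximal-above x L
    in y , ∈-uncons y∈ , x≲y , maximal
    where
    ∈-uncons : ∀ {y} → y ∈ x ∷ L → y ∈ L
    ∈-uncons (here refl) = x∈L
    ∈-uncons (there y∈L) = y∈L

-- If pr(P) ⊆ pr(Q) then P ≼ Q: an interval of σ ∈ P lies below a maximal one,
-- which belongs to pr(Q) and so is an interval of a member of Q.
profile⊆⇒≼ : ∀ {P Q} → (∀ p I → InPr P p I → InPr Q p I) → P ≼ Q
profile⊆⇒≼ {P} pr⊆ σ σ∈P p i σi≡p =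
  let (y , y∈P , σ⊆y , maximal) =
        maximal-in (λ β γ → pInterval p β ⊆ pInterval p γ) (interval-⊆? p) ⊆-refl ⊆-trans P σ∈P
      ((τ , τ∈Q , y⊆τ , _) , _) =
        pr⊆ p (pInterval p y) ((y , y∈P , ⊆-refl , ⊆-refl) , (i , σ⊆y i σi≡p) , maximal)
  in τ , τ∈Q , ⊆-trans σ⊆y y⊆τ

-- Multiplicities

hit : ℕ → ℕ → ℕ
hit v x with v ≟ x
... | yes _ = 1
... | no  _ = 0

hit-self : ∀ v → hit v v ≡ 1
hit-self v with v ≟ v
... | yes _ = refl
... | no v≢v = ⊥-elim (v≢v refl)

hit-miss : ∀ {v x} → v ≢ x → hit v x ≡ 0
hit-miss {v} {x} v≢x with v ≟ x
... | yes v≡x = ⊥-elim (v≢x v≡x)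
... | no  _   = refl

hit-cases : ∀ v x → hit v x ≡ 0 ⊎ v ≡ x
hit-cases v x with v ≟ x
... | yes v≡x = inj₂ v≡x
... | no  _   = inj₁ refl

hit-pos : ∀ v x → 0 < hit v x → x ≡ v
hit-pos v x hit>0 with hit-cases v x
... | inj₁ hit≡0 = ⊥-elim (<-irrefl (sym hit≡0) hit>0)
... | inj₂ v≡x   = sym v≡x

hit-mono : ∀ v x y → (x ≡ v → y ≡ v) → hit v x ≤ hit v y
hit-mono v x y x≡v⇒y≡v with hit-cases v x
... | inj₁ hit≡0 = subst (_≤ hit v y) (sym hit≡0) z≤n
... | inj₂ refl with x≡v⇒y≡v refl
... | refl = ≤-refl

mult : ℕ → List ℕ → ℕ
mult v []       = 0
mult v (x ∷ xs) = hit v x + mult v xs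

mult-absent : ∀ {v} xs → All (v ≢_) xs → mult v xs ≡ 0
mult-absent []       []             = refl
mult-absent (x ∷ xs) (v≢x ∷ absent) = cong₂ _+_ (hit-miss v≢x) (mult-absent xs absent)

mult-above : ∀ {v b} xs → All (_≤ b) xs → b < v → mult v xs ≡ 0
mult-above xs xs≤b b<v = mult-absent xs (all-map (λ x≤b v≡x → <-irrefl (sym v≡x) (≤-<-trans x≤b b<v)) xs≤b)

mult-below : ∀ {v b} xs → All (b ≤_) xs → v < b → mult v xs ≡ 0
mult-below xs b≤xs v<b = mult-absent xs (all-map (λ b≤x v≡x → <-irrefl v≡x (<-≤-trans v<b b≤x)) b≤xs)

mult-++ : ∀ v xs ys → mult v (xs ++ ys) ≡ mult v xs + mult v ys
mult-++ v []       ys = refl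
mult-++ v (x ∷ xs) ys = trans (cong (hit v x +_) (mult-++ v xs ys)) (sym (+-assoc (hit v x) _ _))

mult-take : ∀ v n xs → mult v (take n xs) ≤ mult v xs
mult-take v zero    xs       = z≤n
mult-take v (suc n) []       = z≤n
mult-take v (suc n) (x ∷ xs) = +-monoʳ-≤ (hit v x) (mult-take v n xs)

mult-drop : ∀ v n xs → mult v (drop n xs) ≤ mult v xs
mult-drop v zero    xs       = ≤-refl
mult-drop v (suc n) []       = z≤n
mult-drop v (suc n) (x ∷ xs) = ≤-trans (mult-drop v n xs) (m≤n+m (mult v xs) (hit v x))

sorted-ext : ∀ xs ys → Sorted xs → Sorted ys → (∀ v → mult v xs ≡ mult v ys) → xs ≡ ys
sorted-ext []       []       _ _ same = refl
sorted-ext []       (y ∷ ys) _ _ same with trans (same y) (cong (_+ mult y ys) (hit-self y))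
... | ()
sorted-ext (x ∷ xs) []       _ _ same with trans (sym (same x)) (cong (_+ mult x xs) (hit-self x))
... | ()
sorted-ext (x ∷ xs) (y ∷ ys) (x≥xs ∷ sxs) (y≥ys ∷ sys) same with <-cmp x y
... | tri> _ _ y<x = ⊥-elim (1+n≢0 (begin
      suc (mult x xs)  ≡⟨ cong (_+ mult x xs) (hit-self x) ⟨
      mult x (x ∷ xs)  ≡⟨ same x ⟩
      mult x (y ∷ ys)  ≡⟨ mult-above (y ∷ ys) (≤-refl ∷ y≥ys) y<x ⟩
      0                ∎))
  where open ≡-Reasoning
... | tri< x<y _ _ = ⊥-elim (1+n≢0 (begin
      suc (mult y ys)  ≡⟨ cong (_+ mult y ys) (hit-self y) ⟨
      mult y (y ∷ ys)  ≡⟨ same y ⟨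
      mult y (x ∷ xs)  ≡⟨ mult-above (x ∷ xs) (≤-refl ∷ x≥xs) x<y ⟩
      0                ∎))
  where open ≡-Reasoning
... | tri≈ _ refl _ = cong (x ∷_) (sorted-ext xs ys sxs sys (λ v → +-cancelˡ-≡ (hit v x) _ _ (same v)))

_⊑⟨_⟩_ : List ℕ → ℕ → List ℕ → Set
xs ⊑⟨ v ⟩ ys = ∀ j → idx xs j ≡ v → idx ys j ≡ v

head₀ : List ℕ → ℕ
head₀ []      = 0
head₀ (y ∷ _) = y

tail₀ : List ℕ → List ℕ
tail₀ []       = []
tail₀ (_ ∷ ys) = ys

idx-head₀ : ∀ ys → idx ys 0 ≡ head₀ ys
idx-head₀ []      = refl
idx-head₀ (y ∷ _) = refl

idx-tail₀ : ∀ ys j → idx ys (suc j) ≡ idx (tail₀ ys) j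
idx-tail₀ []       j = refl
idx-tail₀ (y ∷ ys) j = refl

-- For v > 0 the padding does not count.
mult-uncons : ∀ {v} ys → 0 < v → mult v ys ≡ hit v (head₀ ys) + mult v (tail₀ ys)
mult-uncons []       v>0 = sym (cong (_+ 0) (hit-miss (>⇒≢ v>0)))
mult-uncons (y ∷ ys) v>0 = refl

⊑-uncons : ∀ {v x xs} ys → ys ⊑⟨ v ⟩ (x ∷ xs) → (head₀ ys ≡ v → x ≡ v) × tail₀ ys ⊑⟨ v ⟩ xs
⊑-uncons []       ys⊑ = ys⊑ 0 , λ j → ys⊑ (suc j)
⊑-uncons (y ∷ ys) ys⊑ = ys⊑ 0 , λ j → ys⊑ (suc j)

uncons-⊑ : ∀ {v x xs} ys → (x ∷ xs) ⊑⟨ v ⟩ ys → (x ≡ v → head₀ ys ≡ v) × xs ⊑⟨ v ⟩ tail₀ ys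
uncons-⊑ []       ⊑ys = ⊑ys 0 , λ j → ⊑ys (suc j)
uncons-⊑ (y ∷ ys) ⊑ys = ⊑ys 0 , λ j → ⊑ys (suc j)

mult-mono : ∀ {v} xs ys → 0 < v → xs ⊑⟨ v ⟩ ys → mult v xs ≤ mult v ys
mult-mono     []       ys v>0 _   = z≤n
mult-mono {v} (x ∷ xs) ys v>0 ⊑ys = begin
  hit v x + mult v xs                   ≤⟨ +-mono-≤ (hit-mono v x (head₀ ys) (proj₁ split))
                                                    (mult-mono xs (tail₀ ys) v>0 (proj₂ split)) ⟩
  hit v (head₀ ys) + mult v (tail₀ ys)  ≡⟨ mult-uncons ys v>0 ⟨
  mult v ys                             ∎
  where
  open ≤-Reasoning
  split : (x ≡ v → head₀ ys ≡ v) × xs ⊑⟨ v ⟩ tail₀ ys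
  split = uncons-⊑ ys ⊑ys

positions-eq : ∀ {v} xs ys → 0 < v → ys ⊑⟨ v ⟩ xs → mult v xs ≤ mult v ys → xs ⊑⟨ v ⟩ ys
positions-eq     []       ys v>0 _   _     j 0≡v = ⊥-elim (<-irrefl 0≡v v>0)
positions-eq {v} (x ∷ xs) ys v>0 ys⊑ mult≤ = positions
  where
  y   : ℕ
  y   = head₀ ys
  ys' : List ℕ
  ys' = tail₀ ys
  split : (head₀ ys ≡ v → x ≡ v) × tail₀ ys ⊑⟨ v ⟩ xs
  split = ⊑-uncons ys ys⊑
  hit-y≤hit-x : hit v y ≤ hit v x
  hit-y≤hit-x = hit-mono v y x (proj₁ split)
  tails : mult v ys' ≤ mult v xs
  tails = mult-mono ys' xs v>0 (proj₂ split)
  total : hit v x + mult v xs ≤ hit v y + mult v ys'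
  total = ≤-trans mult≤ (≤-reflexive (mult-uncons ys v>0))
  hit-x≤hit-y : hit v x ≤ hit v y
  hit-x≤hit-y = +-cancelʳ-≤ (mult v xs) _ _ (≤-trans total (+-monoʳ-≤ (hit v y) tails))
  tails' : mult v xs ≤ mult v ys'
  tails' = +-cancelˡ-≤ (hit v x) _ _ (≤-trans total (+-monoˡ-≤ (mult v ys') hit-y≤hit-x))
  positions : (x ∷ xs) ⊑⟨ v ⟩ ys
  positions zero    refl = trans (idx-head₀ ys)
    (hit-pos v y (<-≤-trans (≤-reflexive (sym (hit-self v))) hit-x≤hit-y))
  positions (suc j) xsj≡v = trans (idx-tail₀ ys j) (positions-eq xs ys' v>0 (proj₂ split) tails' j xsj≡v)

join-all : ∀ {Q : ℕ → Set} xs ys → All Q xs → All Q ys → All Q (join xs ys)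
join-all []       ys _ Qys = Qys
join-all {Q} (x ∷ xs) ys (Qx ∷ Qxs) Qys = merge ys Qys
  where
  merge : ∀ ys → All Q ys → All Q (join (x ∷ xs) ys)
  merge []       _ = Qx ∷ Qxs
  merge (y ∷ ys) (Qy ∷ Qys) with y <? x | x <? y
  ... | yes _ | _     = Qx ∷ join-all xs (y ∷ ys) Qxs (Qy ∷ Qys)
  ... | no _  | yes _ = Qy ∷ merge ys Qys
  ... | no _  | no _  = Qx ∷ join-all xs ys Qxs Qys

head-bounds : ∀ {y ys} → Sorted (y ∷ ys) → All (_≤ y) (y ∷ ys)
head-bounds (y≥ys ∷ _) = ≤-refl ∷ y≥ys

bounds-weaken : ∀ {a b} xs → All (_≤ a) xs → a ≤ b → All (_≤ b) xs
bounds-weaken xs xs≤a a≤b = all-map (λ x≤a → ≤-trans x≤a a≤b) xs≤a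

join-sorted : ∀ xs ys → Sorted xs → Sorted ys → Sorted (join xs ys)
join-sorted []       ys _ sys = sys
join-sorted (x ∷ xs) ys (x≥xs ∷ sxs) sys = merge ys sys
  where
  merge : ∀ ys → Sorted ys → Sorted (join (x ∷ xs) ys)
  merge []       _ = x≥xs ∷ sxs
  merge (y ∷ ys) (y≥ys ∷ sys) with y <? x | x <? y
  ... | yes y<x | _ =
    join-all xs (y ∷ ys) x≥xs (bounds-weaken (y ∷ ys) (head-bounds (y≥ys ∷ sys)) (<⇒≤ y<x))
    ∷ join-sorted xs (y ∷ ys) sxs (y≥ys ∷ sys)
  ... | no _ | yes x<y =
    join-all (x ∷ xs) ys (bounds-weaken (x ∷ xs) (head-bounds (x≥xs ∷ sxs)) (<⇒≤ x<y)) y≥ys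
    ∷ merge ys sys
  ... | no y≮x | no x≮y with ≤-antisym (≮⇒≥ y≮x) (≮⇒≥ x≮y)
  ... | refl = join-all xs ys x≥xs y≥ys ∷ join-sorted xs ys sxs sys

+-⊔-left : ∀ a b c → (a ≡ 0 ⊎ c ≡ 0) → a + (b ⊔ c) ≡ (a + b) ⊔ c
+-⊔-left .0 b c (inj₁ refl) = refl
+-⊔-left a  b .0 (inj₂ refl) = trans (cong (a +_) (⊔-identityʳ b)) (sym (⊔-identityʳ (a + b)))

+-⊔-right : ∀ a b c → (a ≡ 0 ⊎ b ≡ 0) → a + (b ⊔ c) ≡ b ⊔ (a + c)
+-⊔-right .0 b c (inj₁ refl) = refl
+-⊔-right a .0 c (inj₂ refl) = refl

top-hit : ∀ v x ys → All (_< x) ys → hit v x ≡ 0 ⊎ mult v ys ≡ 0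
top-hit v x ys ys<x with hit-cases v x
... | inj₁ hit≡0 = inj₁ hit≡0
... | inj₂ refl  = inj₂ (mult-absent ys (all-map (λ y<v v≡y → <-irrefl (sym v≡y) y<v) ys<x))

below-head : ∀ {x y} ys → Sorted (y ∷ ys) → y < x → All (_< x) (y ∷ ys)
below-head ys s y<x = all-map (λ z≤y → ≤-<-trans z≤y y<x) (head-bounds s)

join-mult : ∀ v xs ys → Sorted xs → Sorted ys → mult v (join xs ys) ≡ mult v xs ⊔ mult v ys
join-mult v []       ys _ _ = refl
join-mult v (x ∷ xs) ys (x≥xs ∷ sxs) sys = merge ys sys
  where
  merge : ∀ ys → Sorted ys → mult v (join (x ∷ xs) ys) ≡ mult v (x ∷ xs) ⊔ mult v ys
  merge []       _ = sym (⊔-identityʳ _)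
  merge (y ∷ ys) (y≥ys ∷ sys) with y <? x | x <? y
  ... | yes y<x | _ =
    trans (cong (hit v x +_) (join-mult v xs (y ∷ ys) sxs (y≥ys ∷ sys)))
          (+-⊔-left (hit v x) (mult v xs) _ (top-hit v x (y ∷ ys) (below-head ys (y≥ys ∷ sys) y<x)))
  ... | no _ | yes x<y =
    trans (cong (hit v y +_) (merge ys sys))
          (+-⊔-right (hit v y) _ (mult v ys) (top-hit v y (x ∷ xs) (below-head xs (x≥xs ∷ sxs) x<y)))
  ... | no y≮x | no x≮y with ≤-antisym (≮⇒≥ y≮x) (≮⇒≥ x≮y)
  ... | refl = trans (cong (hit v x +_) (join-mult v xs ys sxs sys)) (+-distribˡ-⊔ (hit v x) _ _)

add-bounds : ∀ {a b} xs ys → All (_≤ a) xs → All (_≤ b) ys → All (_≤ a + b) (add xs ys)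
add-bounds {a} {b} []       ys _ ys≤b = bounds-weaken ys ys≤b (m≤n+m b a)
add-bounds {a} {b} (x ∷ xs) [] xs≤a _ = bounds-weaken (x ∷ xs) xs≤a (m≤m+n a b)
add-bounds (x ∷ xs) (y ∷ ys) (x≤a ∷ xs≤a) (y≤b ∷ ys≤b) = +-mono-≤ x≤a y≤b ∷ add-bounds xs ys xs≤a ys≤b

add-sorted : ∀ xs ys → Sorted xs → Sorted ys → Sorted (add xs ys)
add-sorted []       ys _ sys = sys
add-sorted (x ∷ xs) [] sxs _ = sxs
add-sorted (x ∷ xs) (y ∷ ys) (x≥xs ∷ sxs) (y≥ys ∷ sys) = add-bounds xs ys x≥xs y≥ys ∷ add-sorted xs ys sxs sys

idx-add : ∀ μ α j → idx (add μ α) j ≡ idx μ j + idx α j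
idx-add []      α       j       = refl
idx-add (m ∷ μ) []      j       = sym (+-identityʳ _)
idx-add (m ∷ μ) (a ∷ α) zero    = refl
idx-add (m ∷ μ) (a ∷ α) (suc j) = idx-add μ α j

add-identityʳ : ∀ xs → add xs [] ≡ xs
add-identityʳ []       = refl
add-identityʳ (x ∷ xs) = refl

take-add : ∀ n μ α → take n (add μ α) ≡ add (take n μ) (take n α)
take-add zero    μ       α       = refl
take-add (suc n) []      α       = refl
take-add (suc n) (m ∷ μ) []      = refl
take-add (suc n) (m ∷ μ) (a ∷ α) = cong (m + a ∷_) (take-add n μ α)

drop-add : ∀ n μ α → drop n (add μ α) ≡ add (drop n μ) (drop n α)
drop-add zero    μ       α       = refl
drop-add (suc n) []      α       = refl
drop-add (suc n) (m ∷ μ) []      = sym (add-identityʳ (drop n μ))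
drop-add (suc n) (m ∷ μ) (a ∷ α) = drop-add n μ α

add-splice : ∀ k μ α β → 0 < idx α k → add μ (splice k α β) ≡ splice k (add μ α) (add μ β)
add-splice k μ α β αk>0 = begin
  add μ γ                                                   ≡⟨ take++drop≡id n (add μ γ) ⟨
  take n (add μ γ) ++ drop n (add μ γ)                      ≡⟨ cong₂ _++_ (take-add n μ γ) (drop-add n μ γ) ⟩
  add (take n μ) (take n γ) ++ add (drop n μ) (drop n γ)    ≡⟨ cong₂ (λ xs ys → add (take n μ) xs ++ add (drop n μ) ys)
                                                                     (take-prefix k α _ αk>0) (drop-prefix k α _ αk>0) ⟩
  add (take n μ) (take n α) ++ add (drop n μ) (drop n β)    ≡⟨ cong₂ _++_ (take-add n μ α) (drop-add n μ β) ⟨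
  splice k (add μ α) (add μ β)                              ∎
  where
  open ≡-Reasoning
  n : ℕ
  n = suc k
  γ : List ℕ
  γ = splice k α β

-- A splice at a strict descent of two sorted lists: every value lies entirely
-- on one side of the cut, so its multiplicity is at most the larger of the two.
splice-mult : ∀ v k xs ys → Sorted xs → Sorted ys → idx ys (suc k) < idx xs k →
              mult v (splice k xs ys) ≤ mult v xs ⊔ mult v ys
splice-mult v k xs ys sxs sys guard with v ≤? idx ys (suc k)
... | yes v≤ = begin
  mult v (splice k xs ys)                               ≡⟨ mult-++ v (take n xs) (drop n ys) ⟩
  mult v (take n xs) + mult v (drop n ys)               ≡⟨ cong (_+ mult v (drop n ys))
                                                             (mult-below (take n xs) (take-≥ k xs sxs) (≤-<-trans v≤ guard)) ⟩
  mult v (drop n ys)                                    ≤⟨ mult-drop v n ys ⟩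
  mult v ys                                             ≤⟨ m≤n⊔m _ _ ⟩
  mult v xs ⊔ mult v ys                                 ∎
  where
  open ≤-Reasoning
  n : ℕ
  n = suc k
... | no v≰ = begin
  mult v (splice k xs ys)                               ≡⟨ mult-++ v (take n xs) (drop n ys) ⟩
  mult v (take n xs) + mult v (drop n ys)               ≡⟨ cong (mult v (take n xs) +_)
                                                             (mult-above (drop n ys) (drop-≤ n ys sys) (≰⇒> v≰)) ⟩
  mult v (take n xs) + 0                                ≡⟨ +-identityʳ _ ⟩
  mult v (take n xs)                                    ≤⟨ mult-take v n xs ⟩
  mult v xs                                             ≤⟨ m≤m⊔n _ _ ⟩
  mult v xs ⊔ mult v ys                                 ∎
  where
  open ≤-Reasoning
  n : ℕ
  n = suc k

maxMult : ℕ → List ℕ → List (List ℕ) → ℕ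
maxMult v μ P = foldr (λ α m → mult v (add μ α) ⊔ m) 0 P

maxMult-member : ∀ v μ {α} P → α ∈ P → mult v (add μ α) ≤ maxMult v μ P
maxMult-member v μ (β ∷ P) (here refl) = m≤m⊔n _ _
maxMult-member v μ (β ∷ P) (there α∈P) = ≤-trans (maxMult-member v μ P α∈P) (m≤n⊔m _ _)

maxMult-lub : ∀ v μ P {b} → (∀ α → α ∈ P → mult v (add μ α) ≤ b) → maxMult v μ P ≤ b
maxMult-lub v μ []      bound = z≤n
maxMult-lub v μ (β ∷ P) bound = ⊔-lub (bound β (here refl)) (maxMult-lub v μ P (λ α α∈P → bound α (there α∈P)))

maxMult-attained : ∀ v μ P → P ≢ [] → Σ (List ℕ) λ β → β ∈ P × maxMult v μ P ≤ mult v (add μ β)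
maxMult-attained v μ []          P≢[] = ⊥-elim (P≢[] refl)
maxMult-attained v μ (β ∷ [])    _    = β , here refl , ≤-reflexive (⊔-identityʳ _)
maxMult-attained v μ (β ∷ γ ∷ P) _ with maxMult-attained v μ (γ ∷ P) (λ ())
... | δ , δ∈P , max≤δ with mult v (add μ β) ≤? mult v (add μ δ)
...   | yes β≤δ = δ , there δ∈P , ⊔-lub β≤δ max≤δ
...   | no  β≰δ = β , here refl , ⊔-lub ≤-refl (≤-trans max≤δ (<⇒≤ (≰⇒> β≰δ)))

joinAll-sorted : ∀ μ P → Sorted μ → All Sorted P → Sorted (joinAll P μ)
joinAll-sorted μ []      _  _          = []
joinAll-sorted μ (α ∷ P) sμ (sα ∷ sP) =
  join-sorted (add μ α) (joinAll P μ) (add-sorted μ α sμ sα) (joinAll-sorted μ P sμ sP)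

joinAll-mult : ∀ v μ P → Sorted μ → All Sorted P → mult v (joinAll P μ) ≡ maxMult v μ P
joinAll-mult v μ []      _  _          = refl
joinAll-mult v μ (α ∷ P) sμ (sα ∷ sP) =
  trans (join-mult v (add μ α) (joinAll P μ) (add-sorted μ α sμ sα) (joinAll-sorted μ P sμ sP))
        (cong (mult v (add μ α) ⊔_) (joinAll-mult v μ P sμ sP))

closure-mult : ∀ v {μ Q γ} → Sorted μ → All Partition Q → Cl Q γ → mult v (add μ γ) ≤ maxMult v μ Q
closure-mult v {μ} {Q} sμ ps (base γ∈Q) = maxMult-member v μ Q γ∈Q
closure-mult v {μ} {Q} sμ ps (splice-step {α} {β} k cα cβ guard) = begin
  mult v (add μ (splice k α β))          ≡⟨ cong (mult v) (add-splice k μ α β (≤-<-trans z≤n guard)) ⟩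
  mult v (splice k (add μ α) (add μ β))  ≤⟨ splice-mult v k _ _ (add-sorted μ α sμ sα) (add-sorted μ β sμ sβ) sum-guard ⟩
  mult v (add μ α) ⊔ mult v (add μ β)    ≤⟨ ⊔-lub (closure-mult v sμ ps cα) (closure-mult v sμ ps cβ) ⟩
  maxMult v μ Q                          ∎
  where
  open ≤-Reasoning
  sα : Sorted α
  sα = proj₁ (closure-partition ps cα)
  sβ : Sorted β
  sβ = proj₁ (closure-partition ps cβ)
  sum-guard : idx (add μ β) (suc k) < idx (add μ α) k
  sum-guard = subst₂ _<_ (sym (idx-add μ β (suc k))) (sym (idx-add μ α k))
                         (+-mono-≤-< (idx-antitone μ sμ (n≤1+n k)) guard)

closure⊆⇒maxMult≤ : ∀ v {μ P Q} → Sorted μ → All Partition Q → (∀ σ → Cl P σ → Cl Q σ) →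
                    maxMult v μ P ≤ maxMult v μ Q
closure⊆⇒maxMult≤ v {μ} {P} sμ psQ cl⊆ = maxMult-lub v μ P (λ α α∈P → closure-mult v sμ psQ (cl⊆ α (base α∈P)))

closure≡⇒joins≡ : ∀ {P Q} → All Partition P → All Partition Q → (∀ σ → Cl P σ ⟺ Cl Q σ) →
                  ∀ μ → IsPartition μ → joinAll P μ ≡ joinAll Q μ
closure≡⇒joins≡ {P} {Q} psP psQ cl≡ μ μ-part =
  sorted-ext _ _ (joinAll-sorted μ P sμ sP) (joinAll-sorted μ Q sμ sQ) λ v → begin
    mult v (joinAll P μ)  ≡⟨ joinAll-mult v μ P sμ sP ⟩
    maxMult v μ P         ≡⟨ ≤-antisym (closure⊆⇒maxMult≤ v sμ psQ (λ σ → proj₁ (cl≡ σ)))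
                                       (closure⊆⇒maxMult≤ v sμ psP (λ σ → proj₂ (cl≡ σ))) ⟩
    maxMult v μ Q         ≡⟨ joinAll-mult v μ Q sμ sQ ⟨
    mult v (joinAll Q μ)  ∎
  where
  open ≡-Reasoning
  sμ : Sorted μ
  sμ = proj₁ (fromIsPartition μ-part)
  sP : All Sorted P
  sP = all-map proj₁ psP
  sQ : All Sorted Q
  sQ = all-map proj₁ psQ

-- Test partitions

Bounded : ℕ → List ℕ → Set
Bounded B β = ∀ j → idx β j ≤ B

entryBound : List (List ℕ) → ℕ
entryBound L = sum (map sum L)

idx-≤-sum : ∀ xs j → idx xs j ≤ sum xs
idx-≤-sum []       j       = z≤n
idx-≤-sum (x ∷ xs) zero    = m≤m+n x (sum xs)
idx-≤-sum (x ∷ xs) (suc j) = ≤-trans (idx-≤-sum xs j) (m≤n+m _ x)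

entryBound-member : ∀ {β} L → β ∈ L → Bounded (entryBound L) β
entryBound-member (γ ∷ L) (here refl)  j = ≤-trans (idx-≤-sum γ j) (m≤m+n _ _)
entryBound-member (γ ∷ L) (there β∈L) j = ≤-trans (entryBound-member L β∈L j) (m≤n+m _ (sum γ))

Detects : List ℕ → ℕ → (ℕ → Set) → ℕ → List ℕ → Set
Detects μ v T p β = ∀ j → (idx μ j + idx β j ≡ v → T j × idx β j ≡ p)
                        × (T j → idx β j ≡ p → idx μ j + idx β j ≡ v)

-- The test for the 0-interval of a partition of length ℓ with entries ≤ B:
-- μ = (2N, …, 2N, N) with ℓ copies of 2N and N > B, v = N, T = {ℓ}.
module ZeroTest (ℓ B : ℕ) where
  N : ℕ
  N = suc B

  μ : List ℕ
  μ = replicate ℓ (N + N) ++ N ∷ []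

  μ-partition : Partition μ
  μ-partition = sorted ℓ , positive ℓ
    where
    positive : ∀ n → Positive (replicate n (N + N) ++ N ∷ [])
    positive zero    = z<s ∷ []
    positive (suc n) = z<s ∷ positive n
    bounded : ∀ n → All (_≤ N + N) (replicate n (N + N) ++ N ∷ [])
    bounded zero    = m≤m+n N N ∷ []
    bounded (suc n) = ≤-refl ∷ bounded n
    sorted : ∀ n → Sorted (replicate n (N + N) ++ N ∷ [])
    sorted zero    = [] ∷ []
    sorted (suc n) = bounded n ∷ sorted n

  idx-before : ∀ j → j < ℓ → idx μ j ≡ N + N
  idx-before j j<ℓ = go ℓ j j<ℓ
    where
    go : ∀ n j → j < n → idx (replicate n (N + N) ++ N ∷ []) j ≡ N + N
    go (suc n) zero    _         = refl
    go (suc n) (suc j) (s≤s j<n) = go n j j<n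

  idx-at : idx μ ℓ ≡ N
  idx-at = go ℓ
    where
    go : ∀ n → idx (replicate n (N + N) ++ N ∷ []) n ≡ N
    go zero    = refl
    go (suc n) = go n

  idx-after : ∀ j → ℓ < j → idx μ j ≡ 0
  idx-after j ℓ<j = idx-beyond μ j (subst (_≤ j) (sym length-μ) ℓ<j)
    where
    length-μ : length μ ≡ suc ℓ
    length-μ = go ℓ
      where
      go : ∀ n → length (replicate n (N + N) ++ N ∷ []) ≡ suc n
      go zero    = refl
      go (suc n) = cong suc (go n)

  detects : ∀ β → Bounded B β → Detects μ N (_≡ ℓ) 0 β
  detects β β≤B j = hit⇒ , hit⇐
    where
    open ≤-Reasoning
    hit⇒ : idx μ j + idx β j ≡ N → j ≡ ℓ × idx β j ≡ 0
    hit⇒ hit with <-cmp j ℓ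
    ... | tri< j<ℓ _ _ = ⊥-elim (<-irrefl (sym hit) (begin-strict
          N                   <⟨ m<m+n N z<s ⟩
          N + N               ≤⟨ m≤m+n (N + N) (idx β j) ⟩
          N + N + idx β j     ≡⟨ cong (_+ idx β j) (idx-before j j<ℓ) ⟨
          idx μ j + idx β j   ∎))
    ... | tri≈ _ refl _ = refl , +-cancelˡ-≡ N _ _ (begin-equality
          N + idx β j         ≡⟨ cong (_+ idx β j) idx-at ⟨
          idx μ j + idx β j   ≡⟨ hit ⟩
          N                   ≡⟨ +-identityʳ N ⟨
          N + 0               ∎)
    ... | tri> _ _ ℓ<j = ⊥-elim (<-irrefl hit (begin-strict
          idx μ j + idx β j   ≡⟨ cong (_+ idx β j) (idx-after j ℓ<j) ⟩
          idx β j             ≤⟨ β≤B j ⟩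
          B                   <⟨ n<1+n B ⟩
          N                   ∎))
    hit⇐ : j ≡ ℓ → idx β j ≡ 0 → idx μ j + idx β j ≡ N
    hit⇐ refl βℓ≡0 = trans (cong₂ _+_ idx-at βℓ≡0) (+-identityʳ N)

zero-interval : ∀ α β → Positive α → Sorted β → idx β (length α) ≡ 0 → pInterval 0 α ⊆ pInterval 0 β
zero-interval α β pα sβ βℓ≡0 (at j) αj≡0 with j <? length α
... | yes j<ℓ = ⊥-elim (<-irrefl (sym αj≡0) (idx-positive α j pα j<ℓ))
... | no  j≮ℓ = n≤0⇒n≡0 (subst (idx β j ≤_) βℓ≡0 (idx-antitone β sβ (≮⇒≥ j≮ℓ)))
zero-interval α β pα sβ βℓ≡0 ∞ 0≡0 = 0≡0

-- The test for the p-interval (p > 0) of a partition α with entries ≤ B: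
-- μ_j = level(α_j), where level is 0 below p, N at p and 2N above p, with
-- N > p + B; v = N + p and T = {j : α_j = p}.
module PositiveTest (p' B : ℕ) where
  p N : ℕ
  p = suc p'
  N = suc (p + B)

  threshold : ℕ → ℕ → ℕ
  threshold q x with q ≤? x
  ... | yes _ = N
  ... | no  _ = 0

  threshold-yes : ∀ q x → q ≤ x → threshold q x ≡ N
  threshold-yes q x q≤x with q ≤? x
  ... | yes _   = refl
  ... | no  q≰x = ⊥-elim (q≰x q≤x)

  threshold-no : ∀ q x → x < q → threshold q x ≡ 0
  threshold-no q x x<q with q ≤? x
  ... | yes q≤x = ⊥-elim (<-irrefl refl (<-≤-trans x<q q≤x))
  ... | no  _   = refl

  threshold-mono : ∀ q {x y} → x ≤ y → threshold q x ≤ threshold q y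
  threshold-mono q {x} {y} x≤y with q ≤? x | q ≤? y
  ... | yes _   | yes _   = ≤-refl
  ... | no  _   | _       = z≤n
  ... | yes q≤x | no  q≰y = ⊥-elim (q≰y (≤-trans q≤x x≤y))

  level : ℕ → ℕ
  level x = threshold p x + threshold (suc p) x

  level-mono : ∀ {x y} → x ≤ y → level x ≤ level y
  level-mono x≤y = +-mono-≤ (threshold-mono p x≤y) (threshold-mono (suc p) x≤y)

  level-below : ∀ x → x < p → level x ≡ 0
  level-below x x<p = cong₂ _+_ (threshold-no p x x<p) (threshold-no (suc p) x (m<n⇒m<1+n x<p))

  level-at : level p ≡ N
  level-at = trans (cong₂ _+_ (threshold-yes p p ≤-refl) (threshold-no (suc p) p ≤-refl)) (+-identityʳ N)

  level-above : ∀ x → p < x → level x ≡ N + N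
  level-above x p<x = cong₂ _+_ (threshold-yes p x (<⇒≤ p<x)) (threshold-yes (suc p) x p<x)

  level-positive : ∀ x → p ≤ x → 0 < level x
  level-positive x p≤x = <-≤-trans z<s (≤-trans (≤-reflexive (sym (threshold-yes p x p≤x))) (m≤m+n _ _))

  level-hit : ∀ x b → b ≤ B → level x + b ≡ N + p → x ≡ p × b ≡ p
  level-hit x b b≤B hit with <-cmp x p
  ... | tri< x<p _ _ = ⊥-elim (<-irrefl hit (begin-strict
        level x + b  ≡⟨ cong (_+ b) (level-below x x<p) ⟩
        b            ≤⟨ b≤B ⟩
        B            <⟨ s≤s (m≤n+m B p) ⟩
        N            ≤⟨ m≤m+n N p ⟩
        N + p        ∎))
    where open ≤-Reasoning
  ... | tri≈ _ refl _ = refl , +-cancelˡ-≡ N _ _ (trans (cong (_+ b) (sym level-at)) hit)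
  ... | tri> _ _ p<x = ⊥-elim (<-irrefl (sym hit) (begin-strict
        N + p        <⟨ +-monoʳ-< N (s≤s (m≤m+n p B)) ⟩
        N + N        ≤⟨ m≤m+n (N + N) b ⟩
        N + N + b    ≡⟨ cong (_+ b) (level-above x p<x) ⟨
        level x + b  ∎))
    where open ≤-Reasoning

  -- The levels of the entries ≥ p of a list (the rest have level 0).
  levels : List ℕ → List ℕ
  levels []       = []
  levels (x ∷ xs) with x <? p
  ... | yes _ = []
  ... | no  _ = level x ∷ levels xs

  levels-all : ∀ {Q : ℕ → Set} xs → All (λ y → p ≤ y → Q (level y)) xs → All Q (levels xs)
  levels-all []       []         = []
  levels-all (x ∷ xs) (Qx ∷ Qxs) with x <? p
  ... | yes _   = []
  ... | no  x≮p = Qx (≮⇒≥ x≮p) ∷ levels-all xs Qxs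

  levels-partition : ∀ xs → Sorted xs → Partition (levels xs)
  levels-partition xs sxs = sorted xs sxs , levels-all xs (universal level-positive xs)
    where
    sorted : ∀ xs → Sorted xs → Sorted (levels xs)
    sorted []       _            = []
    sorted (x ∷ xs) (x≥xs ∷ sxs) with x <? p
    ... | yes _ = []
    ... | no  _ = levels-all xs (all-map (λ y≤x _ → level-mono y≤x) x≥xs) ∷ sorted xs sxs

  idx-levels : ∀ xs → Sorted xs → ∀ j → idx (levels xs) j ≡ level (idx xs j)
  idx-levels []       _ j = sym (level-below 0 z<s)
  idx-levels (x ∷ xs) (x≥xs ∷ sxs) j with x <? p
  ... | yes x<p = sym (level-below _ (≤-<-trans (idx-≤ (x ∷ xs) j (head-bounds (x≥xs ∷ sxs))) x<p))
  ... | no  _ with j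
  ...   | zero   = refl
  ...   | suc j' = idx-levels xs sxs j'

  detects : ∀ α → Sorted α → ∀ β → Bounded B β → Detects (levels α) (N + p) (λ j → idx α j ≡ p) p β
  detects α sα β β≤B j = hit⇒ , hit⇐
    where
    μj≡ : idx (levels α) j ≡ level (idx α j)
    μj≡ = idx-levels α sα j
    hit⇒ : idx (levels α) j + idx β j ≡ N + p → idx α j ≡ p × idx β j ≡ p
    hit⇒ hit = level-hit (idx α j) (idx β j) (β≤B j) (trans (cong (_+ idx β j) (sym μj≡)) hit)
    hit⇐ : idx α j ≡ p → idx β j ≡ p → idx (levels α) j + idx β j ≡ N + p
    hit⇐ αj≡p βj≡p = cong₂ _+_ (trans μj≡ (trans (cong level αj≡p) level-at)) βj≡p

module Detection {P Q : List (List ℕ)} (psP : All Partition P) (psQ : All Partition Q) (Q≢[] : Q ≢ [])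
                 (joins≡ : ∀ μ → IsPartition μ → joinAll P μ ≡ joinAll Q μ) where

  -- If no μ + β (β ∈ Q) has v-positions outside those of μ + α, then some β ∈ Q
  -- has all of them: otherwise v would occur in μ + α more often than its
  -- maximum over Q, which equals its maximum over P.
  detect : ∀ {α} → α ∈ P → ∀ μ → Partition μ → ∀ v → 0 < v →
           (∀ β → β ∈ Q → add μ β ⊑⟨ v ⟩ add μ α) → Σ (List ℕ) λ β → β ∈ Q × add μ α ⊑⟨ v ⟩ add μ β
  detect {α} α∈P μ μ-part v v>0 below with maxMult-attained v μ Q Q≢[]
  ... | β , β∈Q , max≤β = β , β∈Q , positions-eq (add μ α) (add μ β) v>0 (below β β∈Q) (begin
        mult v (add μ α)      ≤⟨ maxMult-member v μ P α∈P ⟩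
        maxMult v μ P         ≡⟨ joinAll-mult v μ P sμ sP ⟨
        mult v (joinAll P μ)  ≡⟨ cong (mult v) (joins≡ μ (toIsPartition μ-part)) ⟩
        mult v (joinAll Q μ)  ≡⟨ joinAll-mult v μ Q sμ sQ ⟩
        maxMult v μ Q         ≤⟨ max≤β ⟩
        mult v (add μ β)      ∎)
    where
    open ≤-Reasoning
    sμ : Sorted μ
    sμ = proj₁ μ-part
    sP : All Sorted P
    sP = all-map proj₁ psP
    sQ : All Sorted Q
    sQ = all-map proj₁ psQ

  detect-interval : ∀ {α} → α ∈ P → ∀ μ → Partition μ → ∀ v → 0 < v → ∀ (T : ℕ → Set) p →
                    (∀ β → β ∈ α ∷ Q → Detects μ v T p β) → (∀ j → T j → idx α j ≡ p) →
                    Σ (List ℕ) λ β → β ∈ Q × (∀ j → T j → idx β j ≡ p)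
  detect-interval {α} α∈P μ μ-part v v>0 T p detects α-on-T =
    let (β , β∈Q , α⊑β) = detect α∈P μ μ-part v v>0 below
    in β , β∈Q , λ j Tj → proj₂ (proj₁ (detects β (there β∈Q) j)
                                      (trans (sym (idx-add μ β j)) (α⊑β j (α-hits j Tj))))
    where
    α-hits : ∀ j → T j → idx (add μ α) j ≡ v
    α-hits j Tj = trans (idx-add μ α j) (proj₂ (detects α (here refl) j) Tj (α-on-T j Tj))
    below : ∀ β → β ∈ Q → add μ β ⊑⟨ v ⟩ add μ α
    below β β∈Q j β-hit = α-hits j (proj₁ (proj₁ (detects β (there β∈Q) j) (trans (sym (idx-add μ β j)) β-hit)))

  zero-interval-covered : ∀ {α} → α ∈ P → Σ (List ℕ) λ β → β ∈ Q × pInterval 0 α ⊆ pInterval 0 β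
  zero-interval-covered {α} α∈P =
    let (β , β∈Q , β-on-T) = detect-interval α∈P μ μ-partition N z<s (_≡ ℓ) 0
                               (λ β β∈ → detects β (entryBound-member (α ∷ Q) β∈))
                               (λ { j refl → idx-beyond α ℓ ≤-refl })
    in β , β∈Q , zero-interval α β (proj₂ (lookup psP α∈P)) (proj₁ (lookup psQ β∈Q)) (β-on-T ℓ refl)
    where
    ℓ : ℕ
    ℓ = length α
    open ZeroTest ℓ (entryBound (α ∷ Q))

  positive-interval-covered : ∀ {α} → α ∈ P → ∀ p' →
                              Σ (List ℕ) λ β → β ∈ Q × pInterval (suc p') α ⊆ pInterval (suc p') β
  positive-interval-covered {α} α∈P p' =
    let (β , β∈Q , β-on-T) = detect-interval α∈P (levels α) (levels-partition α sα) (N + p) z<s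
                               (λ j → idx α j ≡ p) p
                               (λ β β∈ → detects α sα β (entryBound-member (α ∷ Q) β∈))
                               (λ j αj≡p → αj≡p)
    in β , β∈Q , λ { (at j) αj≡p → β-on-T j αj≡p ; ∞ () }
    where
    sα : Sorted α
    sα = proj₁ (lookup psP α∈P)
    open PositiveTest p' (entryBound (α ∷ Q))

  joins≡⇒≼ : P ≼ Q
  joins≡⇒≼ α α∈P zero     _ _ = zero-interval-covered α∈P
  joins≡⇒≼ α α∈P (suc p') _ _ = positive-interval-covered α∈P p'

theorem4p4 : (P Q : List (List ℕ)) → All IsPartition P → All IsPartition Q →
    P ≢ [] → Q ≢ [] →
    ((∀ σ → Cl P σ ⟺ Cl Q σ) ⟺ (∀ p (I : Idx → Set) → InPr P p I ⟺ InPr Q p I))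
    × ((∀ p (I : Idx → Set) → InPr P p I ⟺ InPr Q p I)
       ⟺ (∀ μ → IsPartition μ → joinAll P μ ≡ joinAll Q μ))
theorem4p4 P Q isP isQ P≢[] Q≢[] =
  (≼⇒profiles ∘ closures⇒≼ , closures ∘ profiles⇒≼) ,
  (closure≡⇒joins≡ psP psQ ∘ closures ∘ profiles⇒≼ , ≼⇒profiles ∘ joins⇒≼)
  where
  psP : All Partition P
  psP = all-map fromIsPartition isP
  psQ : All Partition Q
  psQ = all-map fromIsPartition isQ
  Mutual : Set
  Mutual = P ≼ Q × Q ≼ P
  closures⇒≼ : (∀ σ → Cl P σ ⟺ Cl Q σ) → Mutual
  closures⇒≼ cl≡ = closure⊆⇒≼ psQ (proj₁ ∘ cl≡) , closure⊆⇒≼ psP (proj₂ ∘ cl≡)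
  closures : Mutual → ∀ σ → Cl P σ ⟺ Cl Q σ
  closures (P≼Q , Q≼P) σ = ≼⇒closure⊆ psP psQ P≼Q σ , ≼⇒closure⊆ psQ psP Q≼P σ
  profiles⇒≼ : (∀ p I → InPr P p I ⟺ InPr Q p I) → Mutual
  profiles⇒≼ pr≡ = profile⊆⇒≼ (λ p I → proj₁ (pr≡ p I)) , profile⊆⇒≼ (λ p I → proj₂ (pr≡ p I))
  ≼⇒profiles : Mutual → ∀ p I → InPr P p I ⟺ InPr Q p I
  ≼⇒profiles (P≼Q , Q≼P) p I = profile⊆ P≼Q Q≼P p I , profile⊆ Q≼P P≼Q p I
  joins⇒≼ : (∀ μ → IsPartition μ → joinAll P μ ≡ joinAll Q μ) → Mutual
  joins⇒≼ joins≡ = Detection.joins≡⇒≼ psP psQ Q≢[] joins≡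
                 , Detection.joins≡⇒≼ psQ psP P≢[] (λ μ μ-part → sym (joins≡ μ μ-part))
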